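{- If $D$ is a bipartite digraph, then ${\rm ndi}(D)\le\Delta^*(D)+2$.
   Context: All digraphs are finite, without loops and without multiple arcs (opposite arcs allowed). A digraph is bipartite if its underlying simple undirected graph (obtained by replacing each arc or pair of opposite arcs by an edge) is bipartite. $\Delta^*(D)$ is the maximum of the maximum outdegree and the maximum indegree of $D$. A (proper) $k$-arc-colouring of $D$ is a map $\gamma$ from $A(D)$ to a set of $k$ colours such that arcs with the same head get distinct colours and arcs with the same tail get distinct colours. $S_\gamma^+(u)$, $S_\gamma^-(u)$ are the sets of colours on arcs with tail $u$, resp. head $u$. $\gamma$ is neighbour-distinguishing if for every arc $uv$, $(S_\gamma^+(u),S_\gamma^-(u))\neq(S_\gamma^+(v),S_\gamma^-(v))$ as ordered pairs. ${\rm ndi}(D)$ is the minimum number of colours of a neighbour-distinguishing arc-colouring of $D$. -}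

module Defs where

open import Data.Nat using (ℕ; _⊔_)
open import Data.Bool using (Bool; true; false; T)
open import Data.Fin using (Fin)
open import Data.List using (List; length; filterᵇ; allFin; foldr; map)
open import Data.Product using (Σ; ∃; _×_; _,_)
open import Relation.Binary.PropositionalEquality using (_≡_; _≢_)
open import Relation.Nullary using (¬_)

-- A finite digraph on vertex set Fin n: arc u v = true iff uv is an arc.
-- No loops; opposite arcs allowed; no multiple arcs (a relation).
record Digraph : Set where
  field
    n        : ℕ
    arc      : Fin n → Fin n → Bool
    loopless : ∀ v → arc v v ≡ false
open Digraph public

module _ (D : Digraph) where

  Arc : Fin (n D) → Fin (n D) → Set
  Arc u v = T (arc D u v)

  outdeg : Fin (n D) → ℕ
  outdeg u = length (filterᵇ (λ v → arc D u v) (allFin (n D)))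

  indeg : Fin (n D) → ℕ
  indeg v = length (filterᵇ (λ u → arc D u v) (allFin (n D)))

  Δ* : ℕ
  Δ* = foldr _⊔_ 0 (map (λ u → outdeg u ⊔ indeg u) (allFin (n D)))

  Bipartite : Set
  Bipartite = Σ (Fin (n D) → Bool) λ side →
    ∀ u v → Arc u v → side u ≢ side v

  ArcColouring : ℕ → Set
  ArcColouring k = (u v : Fin (n D)) → Arc u v → Fin k

  module _ {k : ℕ} (γ : ArcColouring k) where

    Proper : Set
    Proper =
      (∀ u v w (p : Arc u v) (q : Arc u w) → v ≢ w → γ u v p ≢ γ u w q) ×
      (∀ u w v (p : Arc u v) (q : Arc w v) → u ≢ w → γ u v p ≢ γ w v q)

    _∈S⁺_ : Fin k → Fin (n D) → Set
    c ∈S⁺ u = ∃ λ v → Σ (Arc u v) λ p → γ u v p ≡ c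

    _∈S⁻_ : Fin k → Fin (n D) → Set
    c ∈S⁻ u = ∃ λ v → Σ (Arc v u) λ p → γ v u p ≡ c

    SameSets : Fin (n D) → Fin (n D) → Set
    SameSets u v =
      (∀ c → (c ∈S⁺ u → c ∈S⁺ v) × (c ∈S⁺ v → c ∈S⁺ u)) ×
      (∀ c → (c ∈S⁻ u → c ∈S⁻ v) × (c ∈S⁻ v → c ∈S⁻ u))

    NeighbourDistinguishing : Set
    NeighbourDistinguishing = ∀ u v → Arc u v → ¬ SameSets u v

-- Take a maximal matching M of D (a set of arcs, no two sharing a tail or a head,
-- such that every arc shares its tail or its head with an arc of M).  The digraph
-- D ∖ M is properly arc-coloured with Δ*(D) ordinary colours by König's theorem for
-- digraphs (proper arc-colourings of D are the edge-colourings of the bipartite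
-- "tails × heads" graph of D).  Each arc of M receives one of two extra side colours,
-- chosen by the side of its tail in the bipartition.  An arc uv then meets M at u as
-- a tail or at v as a head, and the side colour found there cannot occur at the
-- other end, because the tails of arcs at u and at v lie on opposite sides.
module Submission where

open import Defs
open import Data.Nat using (ℕ; zero; suc; _+_; _≤_; _<_; _≤′_; ≤′-refl; ≤′-step; _⊔_; s≤s; _≤?_)
open import Data.Nat.Properties
  using (≤-trans; ≤-refl; <⇒≱; ≤-<-trans; m≤m⊔n; m≤n⊔m; m≤n⇒m≤n⊔o; m≤n⇒m≤o⊔n; ≤⇒≤′; ≰⇒≥; n<1+n)
open import Data.Bool using (Bool; true; false; T; _∧_)
open import Data.Bool.Properties using (T-∧; ¬-not)
open import Data.Empty using (⊥; ⊥-elim)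
open import Data.Fin using (Fin; toℕ; fromℕ<; _↑ˡ_; _↑ʳ_; splitAt) renaming (zero to 0F; suc to 1+)
open import Data.Fin.Properties
  using (any?; all?; ¬∀⟶∃¬; injective⇒≤; pigeonhole; toℕ≤pred[n]; toℕ-fromℕ<;
         ↑ˡ-injective; ↑ʳ-injective; splitAt-↑ˡ; splitAt-↑ʳ)
  renaming (_≟_ to _≟ᶠ_)
open import Data.Fin.Permutation.Components using (transpose; transpose-inverse)
open import Data.Maybe using (Maybe; just; nothing; _>>=_)
import Data.Maybe as Maybe
open import Data.Maybe.Properties using (just-injective) renaming (≡-dec to ≡-decᵐ)
open import Data.List using (List; []; _∷_; length; lookup; filter; filterᵇ; allFin; foldr; map; cartesianProduct)
open import Data.List.Properties using (filter-notAll; foldr-preservesᵒ)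
open import Data.List.Membership.Propositional using (_∈_)
open import Data.List.Membership.Propositional.Properties using (∈-allFin; ∈-filter⁺; ∈-cartesianProduct⁺)
open import Data.List.Relation.Unary.Any as Any using (Any; here; there; index)
open import Data.List.Relation.Unary.Any.Properties using (lookup-index; map⁺)
open import Data.List.Relation.Binary.Sublist.Propositional using (⊆-refl)
open import Data.List.Relation.Binary.Sublist.Propositional.Properties using (filter⁺; length-mono-≤)
open import Data.Product using (Σ; ∃; _×_; _,_; proj₁; proj₂)
open import Data.Sum using (_⊎_; inj₁; inj₂; [_,_])
open import Function using (id; _∘_; Injective; Equivalence)
open import Relation.Binary.PropositionalEquality
  using (_≡_; _≢_; refl; sym; trans; cong; subst; module ≡-Reasoning)
open import Relation.Nullary using (¬_; Dec; yes; no; ¬?; contradiction)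
open import Relation.Nullary.Decidable using (T?; isNo; fromWitnessFalse; _×-dec_; dec-true; dec-false)
open import Relation.Unary using (Pred; Decidable)

-- A list containing m pairwise distinct values w 0, …, w (m-1) has length at least m:
-- the positions of the w i in the list are themselves pairwise distinct.
distinct-members : ∀ {A : Set} {m} {xs : List A} (w : Fin m → A) →
  Injective _≡_ _≡_ w → (∀ i → w i ∈ xs) → m ≤ length xs
distinct-members {xs = xs} w w-injective w∈xs =
  injective⇒≤ {f = index ∘ w∈xs} λ {i} {j} same-position → w-injective (begin
    w i         ≡⟨ lookup-index (w∈xs i) ⟩
    lookup xs _ ≡⟨ cong (lookup xs) same-position ⟩
    lookup xs _ ≡⟨ sym (lookup-index (w∈xs j)) ⟩
    w j         ∎)
  where open ≡-Reasoning

-- The colour-counting step of König's theorem.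
missing-colour : ∀ {n Δ} (g : Fin n → Maybe (Fin Δ)) (P : Fin n → Bool) →
  (∀ {w c} → g w ≡ just c → T (P w)) →
  (∀ {w w′ c} → g w ≡ just c → g w′ ≡ just c → w ≡ w′) →
  ∀ {v} → T (P v) → g v ≡ nothing →
  length (filterᵇ P (allFin n)) ≤ Δ →
  ∃ λ α → ∀ w → g w ≢ just α
missing-colour {n} {Δ} g P coloured⇒P g-injective {v} Pv v-uncoloured |P|≤Δ
  with all? (λ α → any? (λ w → ≡-decᵐ _≟ᶠ_ (g w) (just α)))
... | no ¬allUsed =
  let α , unused = ¬∀⟶∃¬ Δ _ (λ α → any? (λ w → ≡-decᵐ _≟ᶠ_ (g w) (just α))) ¬allUsed
  in  α , λ w gw≡α → unused (w , gw≡α)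
... | yes allUsed = contradiction |P|≤Δ (<⇒≱ (≤-<-trans
        (distinct-members user user-injective user∈others)
        (filter-notAll (λ w → ¬? (w ≟ᶠ v)) Ps v∈Ps)))
  where
  Ps : List (Fin n)
  Ps = filterᵇ P (allFin n)
  user : Fin Δ → Fin n
  user α = proj₁ (allUsed α)
  user-injective : Injective _≡_ _≡_ user
  user-injective {α} {β} same = just-injective (begin
    just α     ≡⟨ sym (proj₂ (allUsed α)) ⟩
    g (user α) ≡⟨ cong g same ⟩
    g (user β) ≡⟨ proj₂ (allUsed β) ⟩
    just β     ∎)
    where open ≡-Reasoning
  user≢v : ∀ α → user α ≢ v
  user≢v α refl with trans (sym v-uncoloured) (proj₂ (allUsed α))
  ... | ()
  user∈others : ∀ α → user α ∈ filter (λ w → ¬? (w ≟ᶠ v)) Ps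
  user∈others α = ∈-filter⁺ _
    (∈-filter⁺ (T? ∘ P) (∈-allFin _) (coloured⇒P (proj₂ (allUsed α)))) (user≢v α)
  v∈Ps : Any (λ w → ¬ w ≢ v) Ps
  v∈Ps = Any.map (λ { refl v≢v → v≢v refl }) (∈-filter⁺ (T? ∘ P) (∈-allFin v) Pv)

>>=-just : ∀ {A B : Set} (m : Maybe A) {f : A → Maybe B} {b} →
  (m >>= f) ≡ just b → ∃ λ a → m ≡ just a × f a ≡ just b
>>=-just (just a) e = a , refl , e

-- The iterates never repeat, so the orbit stops within n steps; this makes "lies on
-- the orbit" decidable, which the Kempe-chain argument needs.
module Orbit {n} (step : Fin n → Maybe (Fin n))
  (step-injective : ∀ {z z′ y} → step z ≡ just y → step z′ ≡ just y → z ≡ z′)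
  (start : Fin n) (start-unreached : ∀ z → step z ≢ just start) where

  orbit : ℕ → Maybe (Fin n)
  orbit zero    = just start
  orbit (suc k) = orbit k >>= step

  orbit-defined-below : ∀ {i j y} → i ≤′ j → orbit j ≡ just y → ∃ λ x → orbit i ≡ just x
  orbit-defined-below ≤′-refl          e = _ , e
  orbit-defined-below {j = suc j} (≤′-step i≤j) e =
    let x , ej , _ = >>=-just (orbit j) e in orbit-defined-below i≤j ej

  orbit-injective : ∀ {i j y} → i < j → orbit i ≡ just y → orbit j ≡ just y → ⊥
  orbit-injective {zero} {suc j} _ refl ej =
    let z , _ , sz = >>=-just (orbit j) ej in start-unreached z sz
  orbit-injective {suc i} {suc j} (s≤s i<j) ei ej
    with >>=-just (orbit i) ei | >>=-just (orbit j) ej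
  ... | z , ez , sz | z′ , ez′ , sz′ with step-injective sz sz′
  ... | refl = orbit-injective i<j ez ez′

  -- n + 1 pairwise distinct points of Fin n cannot exist
  orbit-stops : orbit n ≡ nothing
  orbit-stops with orbit n in en
  ... | nothing = refl
  ... | just y  = ⊥-elim (orbit-injective i<j (proj₂ (defined i))
                    (subst (λ z → orbit (toℕ j) ≡ just z) (sym same) (proj₂ (defined j))))
    where
    defined : ∀ (k : Fin (suc n)) → ∃ λ x → orbit (toℕ k) ≡ just x
    defined k = orbit-defined-below (≤⇒≤′ (toℕ≤pred[n] k)) en
    value : Fin (suc n) → Fin n
    value k = proj₁ (defined k)
    collision = pigeonhole (n<1+n n) value
    i j : Fin (suc n)
    i = proj₁ collision
    j = proj₁ (proj₂ collision)
    i<j = proj₁ (proj₂ (proj₂ collision))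
    same : value i ≡ value j
    same = proj₂ (proj₂ (proj₂ collision))

  OnOrbit : Fin n → Set
  OnOrbit y = ∃ λ (k : Fin (suc n)) → orbit (toℕ k) ≡ just y

  onOrbit? : ∀ y → Dec (OnOrbit y)
  onOrbit? y = any? (λ k → ≡-decᵐ _≟ᶠ_ (orbit (toℕ k)) (just y))

  -- every defined iterate is on the orbit, since iterates beyond n are undefined
  reached : ∀ k {y} → orbit k ≡ just y → OnOrbit y
  reached k {y} e with k ≤? n
  ... | yes k≤n = fromℕ< (s≤s k≤n) , subst (λ t → orbit t ≡ just y) (sym (toℕ-fromℕ< (s≤s k≤n))) e
  ... | no k≰n with orbit-defined-below (≤⇒≤′ (≰⇒≥ k≰n)) e
  ...   | _ , en = contradiction (trans (sym en) orbit-stops) λ ()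

  start-onOrbit : OnOrbit start
  start-onOrbit = 0F , refl

  onOrbit-step : ∀ {y y′} → OnOrbit y → step y ≡ just y′ → OnOrbit y′
  onOrbit-step (k , e) s = reached (suc (toℕ k)) (trans (cong (_>>= step) e) s)

  onOrbit-pred : ∀ {y} → OnOrbit y → y ≢ start → ∃ λ z → OnOrbit z × step z ≡ just y
  onOrbit-pred {y} (k , e) y≢start = go (toℕ k) e
    where
    go : ∀ m → orbit m ≡ just y → ∃ λ z → OnOrbit z × step z ≡ just y
    go zero    refl = contradiction refl y≢start
    go (suc m) e′   = let z , ez , sz = >>=-just (orbit m) e′ in z , reached m ez , sz

search : ∀ {n p} {P : Pred (Fin n) p} → Decidable P → Maybe (Fin n)
search P? with any? P?
... | yes (x , _) = just x
... | no _        = nothing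

search-sound : ∀ {n p} {P : Pred (Fin n) p} (P? : Decidable P) {x} → search P? ≡ just x → P x
search-sound P? with any? P?
... | yes (x , Px) = λ { refl → Px }

search-complete : ∀ {n p} {P : Pred (Fin n) p} (P? : Decidable P) {x} → P x →
  ∃ λ x′ → search P? ≡ just x′
search-complete P? {x} Px with any? P?
... | yes (x′ , _) = x′ , refl
... | no none      = contradiction (x , Px) none

module Saturation {S I : Set} (Good : S → Set) (_⊑_ : S → S → Set)
  (⊑-refl : ∀ {s} → s ⊑ s) (⊑-trans : ∀ {s t u} → s ⊑ t → t ⊑ u → s ⊑ u)
  (Achieves : S → I → Set) (achieves-mono : ∀ {s t i} → s ⊑ t → Achieves s i → Achieves t i)
  (improve : ∀ {s} i → Good s → Σ S λ t → Good t × s ⊑ t × Achieves t i) where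

  saturate : ∀ (is : List I) {s} → Good s →
    Σ S λ t → Good t × s ⊑ t × (∀ {i} → i ∈ is → Achieves t i)
  saturate []       good = _ , good , ⊑-refl , λ ()
  saturate (i ∷ is) good with improve i good
  ... | t , good-t , s⊑t , t-achieves with saturate is good-t
  ...   | u , good-u , t⊑u , u-achieves = u , good-u , ⊑-trans s⊑t t⊑u , achieved
    where
    achieved : ∀ {j} → j ∈ i ∷ is → Achieves u j
    achieved (here refl)  = achieves-mono t⊑u t-achieves
    achieved (there j∈is) = u-achieves j∈is

allPairs : ∀ n → List (Fin n × Fin n)
allPairs n = cartesianProduct (allFin n) (allFin n)

∈-allPairs : ∀ {n} (x y : Fin n) → (x , y) ∈ allPairs n
∈-allPairs x y = ∈-cartesianProduct⁺ (∈-allFin x) (∈-allFin y)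

module PartialColourings (D : Digraph) (Δ : ℕ) where

  V : Set
  V = Fin (n D)

  Colouring : Set
  Colouring = V → V → Maybe (Fin Δ)

  record IsProper (f : Colouring) : Set where
    field
      on-arcs      : ∀ {x y c} → f x y ≡ just c → Arc D x y
      out-distinct : ∀ {x y y′ c} → f x y ≡ just c → f x y′ ≡ just c → y ≡ y′
      in-distinct  : ∀ {x x′ y c} → f x y ≡ just c → f x′ y ≡ just c → x ≡ x′

  Coloured : Colouring → V → V → Set
  Coloured f x y = ∃ λ c → f x y ≡ just c

  -- g colours (perhaps differently) every arc that f colours
  _⊑_ : Colouring → Colouring → Set
  f ⊑ g = ∀ x y → Coloured f x y → Coloured g x y

  ⊑-refl : ∀ {f} → f ⊑ f
  ⊑-refl _ _ coloured = coloured

  ⊑-trans : ∀ {f g h} → f ⊑ g → g ⊑ h → f ⊑ h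
  ⊑-trans f⊑g g⊑h x y = g⊑h x y ∘ f⊑g x y

  _≟ᶜ_ : (a b : Maybe (Fin Δ)) → Dec (a ≡ b)
  _≟ᶜ_ = ≡-decᵐ _≟ᶠ_

  -- Alternately following
  -- an α-arc backwards and a β-arc forwards from v traces a path; exchanging α and β on
  -- all out-arcs of its tails keeps the colouring proper and frees α at v, while every
  -- tail that missed α before still misses it.
  module KempeChain {f : Colouring} (proper : IsProper f) (α β : Fin Δ) (v : V)
                    (v-misses-β : ∀ x → f x v ≢ just β) where
    open IsProper proper

    next : V → Maybe V
    next y = search (λ x → f x y ≟ᶜ just α) >>= λ x → search (λ y′ → f x y′ ≟ᶜ just β)

    next-sound : ∀ {y y′} → next y ≡ just y′ → ∃ λ x → f x y ≡ just α × f x y′ ≡ just β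
    next-sound {y} e =
      let x , found , found′ = >>=-just (search (λ x → f x y ≟ᶜ just α)) e
      in  x , search-sound _ found , search-sound _ found′

    next-complete : ∀ {x y y′} → f x y ≡ just α → f x y′ ≡ just β → next y ≡ just y′
    next-complete {x} {y} {y′} xy≡α xy′≡β
      with x₀ , found ← search-complete (λ x → f x y ≟ᶜ just α) xy≡α
      with refl ← in-distinct (search-sound _ found) xy≡α
      with y₀ , found′ ← search-complete (λ y′ → f x y′ ≟ᶜ just β) xy′≡β
      with refl ← out-distinct (search-sound _ found′) xy′≡β
      rewrite found = found′

    next-injective : ∀ {z z′ y} → next z ≡ just y → next z′ ≡ just y → z ≡ z′
    next-injective e e′ with next-sound e | next-sound e′
    ... | x , zα , yβ | x′ , z′α , yβ′ with in-distinct yβ yβ′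
    ... | refl = out-distinct zα z′α

    v-unreached : ∀ z → next z ≢ just v
    v-unreached z e = let x , _ , vβ = next-sound e in v-misses-β x vβ

    open Orbit next next-injective v v-unreached

    ChainTail : V → Set
    ChainTail x = ∃ λ y → f x y ≡ just α × OnOrbit y

    chainTail? : ∀ x → Dec (ChainTail x)
    chainTail? x = any? (λ y → (f x y ≟ᶜ just α) ×-dec onOrbit? y)

    tail-α : ∀ {x y} → ChainTail x → f x y ≡ just α → OnOrbit y
    tail-α (y₀ , y₀α , on) yα with out-distinct y₀α yα
    ... | refl = on

    tail-β : ∀ {x y} → ChainTail x → f x y ≡ just β → OnOrbit y
    tail-β (y₀ , y₀α , on) yβ = onOrbit-step on (next-complete y₀α yβ)

    head-α : ∀ {x y} → OnOrbit y → f x y ≡ just α → ChainTail x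
    head-α on yα = _ , yα , on

    head-β : ∀ {x y} → OnOrbit y → f x y ≡ just β → ChainTail x
    head-β {x} on yβ with onOrbit-pred on (λ { refl → v-misses-β x yβ })
    ... | z , on-z , next-z with next-sound next-z
    ... | x′ , zα , yβ′ with in-distinct yβ′ yβ
    ... | refl = z , zα , on-z

    swap : Fin Δ → Fin Δ
    swap = transpose α β

    swap-α : swap α ≡ β
    swap-α rewrite dec-true (α ≟ᶠ α) refl = refl

    swap-β : swap β ≡ α
    swap-β with β ≟ᶠ α
    ... | yes β≡α = β≡α
    ... | no _ rewrite dec-true (β ≟ᶠ β) refl = refl

    swap-fixes : ∀ {c} → c ≢ α → c ≢ β → swap c ≡ c
    swap-fixes {c} c≢α c≢β rewrite dec-false (c ≟ᶠ α) c≢α | dec-false (c ≟ᶠ β) c≢β = refl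

    swap-injective : ∀ {c c′} → swap c ≡ swap c′ → c ≡ c′
    swap-injective {c} {c′} same = begin
      c                      ≡⟨ sym (transpose-inverse β α) ⟩
      transpose β α (swap c)  ≡⟨ cong (transpose β α) same ⟩
      transpose β α (swap c′) ≡⟨ transpose-inverse β α ⟩
      c′                     ∎
      where open ≡-Reasoning

    opaque
      recolour : V → Fin Δ → Fin Δ
      recolour x with chainTail? x
      ... | yes _ = swap
      ... | no _  = id

    RecolourCases : V → Set
    RecolourCases x = (ChainTail x × ∀ c → recolour x c ≡ swap c)
                    ⊎ (¬ ChainTail x × ∀ c → recolour x c ≡ c)

    opaque
      unfolding recolour

      recolour-cases : ∀ x → RecolourCases x
      recolour-cases x with chainTail? x
      ... | yes t  = inj₁ (t , λ _ → refl)
      ... | no ¬t  = inj₂ (¬t , λ _ → refl)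

    recolour-injective : ∀ x {c c′} → recolour x c ≡ recolour x c′ → c ≡ c′
    recolour-injective x {c} {c′} same with recolour-cases x
    ... | inj₁ (_ , sw)    = swap-injective (trans (sym (sw c)) (trans same (sw c′)))
    ... | inj₂ (_ , fixed) = trans (sym (fixed c)) (trans same (fixed c′))

    swap-cases : ∀ c → (c ≡ α × swap c ≡ β) ⊎ (c ≡ β × swap c ≡ α) ⊎ swap c ≡ c
    swap-cases c = cases (c ≟ᶠ α) (c ≟ᶠ β)
      where
      cases : Dec (c ≡ α) → Dec (c ≡ β) →
        (c ≡ α × swap c ≡ β) ⊎ (c ≡ β × swap c ≡ α) ⊎ swap c ≡ c
      cases (yes c≡α) _         = inj₁ (c≡α , trans (cong swap c≡α) swap-α)
      cases (no _)    (yes c≡β) = inj₂ (inj₁ (c≡β , trans (cong swap c≡β) swap-β))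
      cases (no c≢α)  (no c≢β)  = inj₂ (inj₂ (swap-fixes c≢α c≢β))

    recolour-separates : ∀ {x x′ y d d′} → ChainTail x → ¬ ChainTail x′ →
      f x y ≡ just d → f x′ y ≡ just d′ → swap d ≢ d′
    recolour-separates {d = d} t ¬t′ yd yd′ refl with swap-cases d
    ... | inj₁ (refl , sα)        = ¬t′ (head-β (tail-α t yd) (trans yd′ (cong just sα)))
    ... | inj₂ (inj₁ (refl , sβ)) = ¬t′ (head-α (tail-β t yd) (trans yd′ (cong just sβ)))
    ... | inj₂ (inj₂ fixed) with refl ← in-distinct yd (trans yd′ (cong just fixed)) = ¬t′ t

    recoloured : Colouring
    recoloured x y = Maybe.map (recolour x) (f x y)

    recoloured-just : ∀ {x y c} → recoloured x y ≡ just c →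
      ∃ λ d → f x y ≡ just d × recolour x d ≡ c
    recoloured-just {x} {y} e with f x y
    ... | just d = d , refl , just-injective e

    recoloured-extends : f ⊑ recoloured
    recoloured-extends x y (c , xy≡c) = recolour x c , cong (Maybe.map (recolour x)) xy≡c

    recoloured-proper : IsProper recoloured
    recoloured-proper = record
      { on-arcs      = λ e → on-arcs (proj₁ (proj₂ (recoloured-just e)))
      ; out-distinct = out
      ; in-distinct  = into
      }
      where
      out : ∀ {x y y′ c} → recoloured x y ≡ just c → recoloured x y′ ≡ just c → y ≡ y′
      out {x} e e′ with recoloured-just e | recoloured-just e′
      ... | d , yd , rd | d′ , y′d′ , rd′ =
        out-distinct yd (trans y′d′ (cong just (sym (recolour-injective x (trans rd (sym rd′))))))
      into : ∀ {x x′ y c} → recoloured x y ≡ just c → recoloured x′ y ≡ just c → x ≡ x′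
      into {x} {x′} e e′ with recoloured-just e | recoloured-just e′
      ... | d , yd , rd | d′ , yd′ , rd′ = by-cases (recolour-cases x) (recolour-cases x′)
        where
        same : recolour x d ≡ recolour x′ d′
        same = trans rd (sym rd′)
        same-colour : d ≡ d′ → x ≡ x′
        same-colour d≡d′ = in-distinct yd (trans yd′ (cong just (sym d≡d′)))
        by-cases : RecolourCases x → RecolourCases x′ → x ≡ x′
        by-cases (inj₁ (_ , sw)) (inj₁ (_ , sw′)) =
          same-colour (swap-injective (trans (sym (sw d)) (trans same (sw′ d′))))
        by-cases (inj₂ (_ , fixed)) (inj₂ (_ , fixed′)) =
          same-colour (trans (sym (fixed d)) (trans same (fixed′ d′)))
        by-cases (inj₁ (t , sw)) (inj₂ (¬t′ , fixed′)) =
          ⊥-elim (recolour-separates t ¬t′ yd yd′ (trans (sym (sw d)) (trans same (fixed′ d′))))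
        by-cases (inj₂ (¬t , fixed)) (inj₁ (t′ , sw′)) =
          ⊥-elim (recolour-separates t′ ¬t yd′ yd
                   (trans (sym (sw′ d′)) (trans (sym same) (fixed d))))

    v-misses-α : ∀ x → recoloured x v ≢ just α
    v-misses-α x e with recoloured-just e | recolour-cases x
    ... | d , vd , rd | inj₁ (_ , sw) = v-misses-β x (trans vd (cong just
            (swap-injective (trans (trans (sym (sw d)) rd) (sym swap-β)))))
    ... | d , vd , rd | inj₂ (¬t , fixed) =
            ¬t (head-α start-onOrbit (trans vd (cong just (trans (sym (fixed d)) rd))))

    -- a tail without an α-arc is not on the chain, so it still misses α
    misses-α-kept : ∀ {u} → (∀ y → f u y ≢ just α) → ∀ y → recoloured u y ≢ just α
    misses-α-kept {u} u-misses-α y e with recoloured-just e | recolour-cases u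
    ... | d , yd , rd | inj₁ ((y₀ , y₀α , _) , _) = u-misses-α y₀ y₀α
    ... | d , yd , rd | inj₂ (_ , fixed) =
            u-misses-α y (trans yd (cong just (trans (sym (fixed d)) rd)))

  paint : Colouring → V → V → Fin Δ → Colouring
  paint f u v c x y with x ≟ᶠ u | y ≟ᶠ v
  ... | yes _ | yes _ = just c
  ... | _     | _     = f x y

  paint-here : ∀ f u v c → paint f u v c u v ≡ just c
  paint-here f u v c with u ≟ᶠ u | v ≟ᶠ v
  ... | yes _  | yes _  = refl
  ... | no u≢u | _      = contradiction refl u≢u
  ... | yes _  | no v≢v = contradiction refl v≢v

  paint-cases : ∀ f u v c x y {c′} → paint f u v c x y ≡ just c′ →
    (x ≡ u × y ≡ v × c ≡ c′) ⊎ f x y ≡ just c′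
  paint-cases f u v c x y e with x ≟ᶠ u | y ≟ᶠ v
  ... | yes x≡u | yes y≡v = inj₁ (x≡u , y≡v , just-injective e)
  ... | yes _   | no _    = inj₂ e
  ... | no _    | _       = inj₂ e

  paint-extends : ∀ f u v c → f ⊑ paint f u v c
  paint-extends f u v c x y (c′ , xy≡c′) with x ≟ᶠ u | y ≟ᶠ v
  ... | yes _ | yes _ = c , refl
  ... | yes _ | no _  = c′ , xy≡c′
  ... | no _  | _     = c′ , xy≡c′

  paint-proper : ∀ {f u v c} → IsProper f → Arc D u v →
    (∀ y → f u y ≢ just c) → (∀ x → f x v ≢ just c) → IsProper (paint f u v c)
  paint-proper {f} {u} {v} {c} proper uv u-misses v-misses = record
    { on-arcs      = λ {x} {y} → arcs {x} {y}
    ; out-distinct = λ {x} {y} {y′} → out {x} {y} {y′}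
    ; in-distinct  = λ {x} {x′} {y} → into {x} {x′} {y}
    }
    where
    open IsProper proper
    arcs : ∀ {x y c′} → paint f u v c x y ≡ just c′ → Arc D x y
    arcs {x} {y} e with paint-cases f u v c x y e
    ... | inj₁ (refl , refl , _) = uv
    ... | inj₂ xy               = on-arcs xy
    out : ∀ {x y y′ c′} → paint f u v c x y ≡ just c′ → paint f u v c x y′ ≡ just c′ → y ≡ y′
    out {x} {y} {y′} e e′ with paint-cases f u v c x y e | paint-cases f u v c x y′ e′
    ... | inj₁ (_ , refl , _)    | inj₁ (_ , refl , _)    = refl
    ... | inj₁ (refl , _ , refl) | inj₂ xy′               = contradiction xy′ (u-misses y′)
    ... | inj₂ xy                | inj₁ (refl , _ , refl) = contradiction xy (u-misses _)
    ... | inj₂ xy                | inj₂ xy′               = out-distinct xy xy′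
    into : ∀ {x x′ y c′} → paint f u v c x y ≡ just c′ → paint f u v c x′ y ≡ just c′ → x ≡ x′
    into {x} {x′} {y} e e′ with paint-cases f u v c x y e | paint-cases f u v c x′ y e′
    ... | inj₁ (refl , _ , _)    | inj₁ (refl , _ , _)    = refl
    ... | inj₁ (_ , refl , refl) | inj₂ x′y               = contradiction x′y (v-misses x′)
    ... | inj₂ xy                | inj₁ (_ , refl , refl) = contradiction xy (v-misses _)
    ... | inj₂ xy                | inj₂ x′y               = in-distinct xy x′y

  module Bounded (out≤Δ : ∀ u → outdeg D u ≤ Δ) (in≤Δ : ∀ v → indeg D v ≤ Δ) where

    -- The extension step of König's theorem: an uncoloured arc uv can be coloured.  Some
    -- α is free at u and some β at v; the Kempe exchange at v frees α at v as well.
    extend : ∀ {f u v} → IsProper f → Arc D u v → f u v ≡ nothing →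
      Σ Colouring λ g → IsProper g × f ⊑ g × Coloured g u v
    extend {f} {u} {v} proper uv uncoloured =
      paint recoloured u v α ,
      paint-proper {recoloured} {u} {v} {α} recoloured-proper uv
        (misses-α-kept α-free) v-misses-α ,
      ⊑-trans recoloured-extends (paint-extends recoloured u v α) ,
      (α , paint-here recoloured u v α)
      where
      open IsProper proper
      α-missing = missing-colour (f u) (arc D u) on-arcs out-distinct uv uncoloured (out≤Δ u)
      β-missing = missing-colour (λ x → f x v) (λ x → arc D x v) on-arcs in-distinct
                    uv uncoloured (in≤Δ v)
      α : Fin Δ
      α = proj₁ α-missing
      α-free : ∀ y → f u y ≢ just α
      α-free = proj₂ α-missing
      open KempeChain proper α (proj₁ β-missing) v (proj₂ β-missing)

    Handles : Colouring → V × V → Set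
    Handles f (x , y) = Arc D x y → Coloured f x y

    handles-mono : ∀ {f g uv} → f ⊑ g → Handles f uv → Handles g uv
    handles-mono f⊑g handled = f⊑g _ _ ∘ handled

    improve : ∀ {f} uv → IsProper f → Σ Colouring λ g → IsProper g × f ⊑ g × Handles g uv
    improve {f} (u , v) proper with T? (arc D u v) | f u v in uv-colour
    ... | no ¬uv | _       = f , proper , ⊑-refl , λ uv → contradiction uv ¬uv
    ... | yes _  | just c  = f , proper , ⊑-refl , λ _ → c , uv-colour
    ... | yes uv | nothing =
      let g , g-proper , f⊑g , uv-coloured = extend proper uv uv-colour
      in  g , g-proper , f⊑g , λ _ → uv-coloured

    open Saturation IsProper _⊑_ ⊑-refl ⊑-trans Handles handles-mono improve

    konig : Σ (ArcColouring D Δ) (Proper D)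
    konig = γ , out , into
      where
      empty-proper : IsProper (λ _ _ → nothing)
      empty-proper = record { on-arcs = λ () ; out-distinct = λ () ; in-distinct = λ () }
      saturated = saturate (allPairs (n D)) empty-proper
      open IsProper (proj₁ (proj₂ saturated))
      coloured : ∀ u v → Arc D u v → Coloured (proj₁ saturated) u v
      coloured u v = proj₂ (proj₂ (proj₂ saturated)) (∈-allPairs u v)
      γ : ArcColouring D Δ
      γ u v uv = proj₁ (coloured u v uv)
      out : ∀ u v w (p : Arc D u v) (q : Arc D u w) → v ≢ w → γ u v p ≢ γ u w q
      out u v w p q v≢w same = v≢w (out-distinct (proj₂ (coloured u v p))
                                  (trans (proj₂ (coloured u w q)) (cong just (sym same))))
      into : ∀ u w v (p : Arc D u v) (q : Arc D w v) → u ≢ w → γ u v p ≢ γ w v q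
      into u w v p q u≢w same = u≢w (in-distinct (proj₂ (coloured u v p))
                                  (trans (proj₂ (coloured w v q)) (cong just (sym same))))

≤-maximum : ∀ {A : Set} (h : A → ℕ) {x xs} → x ∈ xs → h x ≤ foldr _⊔_ 0 (map h xs)
≤-maximum h {x} x∈xs = foldr-preservesᵒ {P = h x ≤_} {f = _⊔_}
  (λ a b → [ m≤n⇒m≤n⊔o b , m≤n⇒m≤o⊔n a ]) 0 _ (inj₂ (map⁺ (Any.map (λ { refl → ≤-refl }) x∈xs)))

outdeg≤Δ* : ∀ D u → outdeg D u ≤ Δ* D
outdeg≤Δ* D u = ≤-trans (m≤m⊔n _ _) (≤-maximum (λ w → outdeg D w ⊔ indeg D w) (∈-allFin u))

indeg≤Δ* : ∀ D u → indeg D u ≤ Δ* D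
indeg≤Δ* D u = ≤-trans (m≤n⊔m _ _) (≤-maximum (λ w → outdeg D w ⊔ indeg D w) (∈-allFin u))

filter-length-mono : ∀ {A : Set} (p q : A → Bool) → (∀ {x} → T (p x) → T (q x)) →
  ∀ xs → length (filterᵇ p xs) ≤ length (filterᵇ q xs)
filter-length-mono p q p⇒q xs =
  length-mono-≤ (filter⁺ (T? ∘ p) (T? ∘ q) (λ { refl → p⇒q }) (⊆-refl {x = xs}))

subdigraph : (D : Digraph) → (Fin (n D) → Fin (n D) → Bool) → Digraph
subdigraph D keep = record
  { n        = n D
  ; arc      = λ x y → arc D x y ∧ keep x y
  ; loopless = λ v → cong (_∧ keep v v) (loopless D v)
  }

module _ (D : Digraph) (keep : Fin (n D) → Fin (n D) → Bool) where

  sub-arc : ∀ {x y} → Arc D x y → T (keep x y) → Arc (subdigraph D keep) x y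
  sub-arc xy kept = Equivalence.from T-∧ (xy , kept)

  sub-outdeg : ∀ u → outdeg (subdigraph D keep) u ≤ outdeg D u
  sub-outdeg u = filter-length-mono _ _ (proj₁ ∘ Equivalence.to T-∧) (allFin (n D))

  sub-indeg : ∀ v → indeg (subdigraph D keep) v ≤ indeg D v
  sub-indeg v = filter-length-mono _ _ (proj₁ ∘ Equivalence.to T-∧) (allFin (n D))

-- Matchings of a relation R on Fin n, represented as partial injective maps from tails
-- to heads.
module Matchings {n} (R : Fin n → Fin n → Bool) where

  Matching : Set
  Matching = Fin n → Maybe (Fin n)

  record IsMatching (p : Matching) : Set where
    field
      on-arcs   : ∀ {x y} → p x ≡ just y → T (R x y)
      injective : ∀ {x x′ y} → p x ≡ just y → p x′ ≡ just y → x ≡ x′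

  Covers : Matching → Fin n × Fin n → Set
  Covers p (u , v) = T (R u v) → (∃ λ y → p u ≡ just y) ⊎ (∃ λ x → p x ≡ just v)

  _≼_ : Matching → Matching → Set
  p ≼ q = ∀ x y → p x ≡ just y → q x ≡ just y

  ≼-refl : ∀ {p} → p ≼ p
  ≼-refl _ _ px = px

  ≼-trans : ∀ {p q r} → p ≼ q → q ≼ r → p ≼ r
  ≼-trans p≼q q≼r x y = q≼r x y ∘ p≼q x y

  covers-mono : ∀ {p q uv} → p ≼ q → Covers p uv → Covers q uv
  covers-mono p≼q covered uv with covered uv
  ... | inj₁ (y , pu) = inj₁ (y , p≼q _ _ pu)
  ... | inj₂ (x , px) = inj₂ (x , p≼q _ _ px)

  match : Matching → Fin n → Fin n → Matching
  match p u v x with x ≟ᶠ u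
  ... | yes _ = just v
  ... | no _  = p x

  match-here : ∀ p u v → match p u v u ≡ just v
  match-here p u v with u ≟ᶠ u
  ... | yes _  = refl
  ... | no u≢u = contradiction refl u≢u

  match-cases : ∀ p u v x {y} → match p u v x ≡ just y → (x ≡ u × y ≡ v) ⊎ p x ≡ just y
  match-cases p u v x e with x ≟ᶠ u
  ... | yes x≡u = inj₁ (x≡u , sym (just-injective e))
  ... | no _    = inj₂ e

  match-extends : ∀ {p u} v → p u ≡ nothing → p ≼ match p u v
  match-extends {p} {u} v u-free x y px with x ≟ᶠ u
  ... | yes refl = contradiction (trans (sym u-free) px) λ ()
  ... | no _     = px

  match-matching : ∀ {p u v} → IsMatching p → T (R u v) → p u ≡ nothing →
    (∀ x → p x ≢ just v) → IsMatching (match p u v)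
  match-matching {p} {u} {v} m uv u-free v-free = record
    { on-arcs   = λ {x} → arcs {x}
    ; injective = λ {x} {x′} → inj {x} {x′}
    }
    where
    open IsMatching m
    arcs : ∀ {x y} → match p u v x ≡ just y → T (R x y)
    arcs {x} e with match-cases p u v x e
    ... | inj₁ (refl , refl) = uv
    ... | inj₂ px            = on-arcs px
    inj : ∀ {x x′ y} → match p u v x ≡ just y → match p u v x′ ≡ just y → x ≡ x′
    inj {x} {x′} e e′ with match-cases p u v x e | match-cases p u v x′ e′
    ... | inj₁ (refl , _)    | inj₁ (refl , _)    = refl
    ... | inj₁ (_ , refl)    | inj₂ px′           = contradiction px′ (v-free x′)
    ... | inj₂ px            | inj₁ (_ , refl)    = contradiction px (v-free _)
    ... | inj₂ px            | inj₂ px′           = injective px px′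

  cover : ∀ {p} uv → IsMatching p → Σ Matching λ q → IsMatching q × p ≼ q × Covers q uv
  cover {p} (u , v) m
    with T? (R u v) | p u in pu | any? (λ x → ≡-decᵐ _≟ᶠ_ (p x) (just v))
  ... | no ¬uv | _       | _       = p , m , ≼-refl , λ uv → contradiction uv ¬uv
  ... | yes _  | just y  | _       = p , m , ≼-refl , λ _ → inj₁ (y , pu)
  ... | yes _  | nothing | yes hit = p , m , ≼-refl , λ _ → inj₂ hit
  ... | yes uv | nothing | no ¬hit =
    match p u v , match-matching m uv pu (λ x px → ¬hit (x , px)) ,
    match-extends v pu , λ _ → inj₁ (v , match-here p u v)

  open Saturation IsMatching _≼_ ≼-refl ≼-trans Covers covers-mono cover

  maximal-matching : Σ Matching λ p → IsMatching p × ∀ u v → Covers p (u , v)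
  maximal-matching =
    let p , m , _ , covers = saturate (allPairs n) {λ _ → nothing} empty-matching
    in  p , m , λ u v → covers (∈-allPairs u v)
    where
    empty-matching : IsMatching (λ _ → nothing)
    empty-matching = record { on-arcs = λ () ; injective = λ () }

-- The palette Fin (Δ + 2): Δ ordinary colours followed by two side colours, one for
-- each side of the bipartition.
module Palette (Δ : ℕ) where

  bit : Bool → Fin 2
  bit false = 0F
  bit true  = 1+ 0F

  ordinaryColour : Fin Δ → Fin (Δ + 2)
  ordinaryColour c = c ↑ˡ 2

  sideColour : Bool → Fin (Δ + 2)
  sideColour b = Δ ↑ʳ bit b

  ordinaryColour-injective : ∀ {c c′} → ordinaryColour c ≡ ordinaryColour c′ → c ≡ c′
  ordinaryColour-injective = ↑ˡ-injective 2 _ _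

  sideColour-injective : ∀ {a b} → sideColour a ≡ sideColour b → a ≡ b
  sideColour-injective {a} {b} e = bit-injective a b (↑ʳ-injective Δ _ _ e)
    where
    bit-injective : ∀ a b → bit a ≡ bit b → a ≡ b
    bit-injective false false _  = refl
    bit-injective true  true  _  = refl
    bit-injective false true  ()
    bit-injective true  false ()

  ordinary≢side : ∀ {c b} → ordinaryColour c ≢ sideColour b
  ordinary≢side {c} {b} e
    with trans (sym (splitAt-↑ˡ Δ c 2)) (trans (cong (splitAt Δ) e) (splitAt-↑ʳ Δ 2 (bit b)))
  ... | ()

module Construction (D : Digraph) (side : Fin (n D) → Bool) where
  open Matchings (arc D)
  open Palette (Δ* D)

  V : Set
  V = Fin (n D)

  -- Only the stated properties of M and of the ordinary colouring are used, so
  -- their constructions are kept opaque.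
  opaque
    M : Matching
    M = proj₁ maximal-matching

    M-matching : IsMatching M
    M-matching = proj₁ (proj₂ maximal-matching)

    M-maximal : ∀ u v → Covers M (u , v)
    M-maximal = proj₂ (proj₂ maximal-matching)

  open IsMatching M-matching

  _↦?_ : ∀ x y → Dec (M x ≡ just y)
  x ↦? y = ≡-decᵐ _≟ᶠ_ (M x) (just y)

  outside-M : V → V → Bool
  outside-M x y = isNo (x ↦? y)

  D∖M : Digraph
  D∖M = subdigraph D outside-M

  opaque
    ordinary-colouring : Σ (ArcColouring D∖M (Δ* D)) (Proper D∖M)
    ordinary-colouring = PartialColourings.Bounded.konig D∖M (Δ* D)
      (λ u → ≤-trans (sub-outdeg D outside-M u) (outdeg≤Δ* D u))
      (λ v → ≤-trans (sub-indeg D outside-M v) (indeg≤Δ* D v))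

  γ₀ : ArcColouring D∖M (Δ* D)
  γ₀ = proj₁ ordinary-colouring

  γ₀-proper : Proper D∖M γ₀
  γ₀-proper = proj₂ ordinary-colouring

  colour : ∀ {x y} → Arc D x y → Dec (M x ≡ just y) → Fin (Δ* D + 2)
  colour {x}     xy (yes _)   = sideColour (side x)
  colour {x} {y} xy (no x↛y) =
    ordinaryColour (γ₀ x y (sub-arc D outside-M xy (fromWitnessFalse x↛y)))

  γ : ArcColouring D (Δ* D + 2)
  γ x y xy = colour xy (x ↦? y)

  γ-cases : ∀ {x y} (xy : Arc D x y) →
    (M x ≡ just y × γ x y xy ≡ sideColour (side x)) ⊎
    (Σ (Arc D∖M x y) λ xy′ → γ x y xy ≡ ordinaryColour (γ₀ x y xy′))
  γ-cases {x} {y} xy = cases (x ↦? y)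
    where
    cases : (d : Dec (M x ≡ just y)) →
      (M x ≡ just y × colour xy d ≡ sideColour (side x)) ⊎
      (Σ (Arc D∖M x y) λ xy′ → colour xy d ≡ ordinaryColour (γ₀ x y xy′))
    cases (yes x↦y) = inj₁ (x↦y , refl)
    cases (no _)    = inj₂ (_ , refl)

  γ-matched : ∀ {x y} (xy : Arc D x y) → M x ≡ just y → γ x y xy ≡ sideColour (side x)
  γ-matched {x} {y} xy x↦y = matched (x ↦? y)
    where
    matched : (d : Dec (M x ≡ just y)) → colour xy d ≡ sideColour (side x)
    matched (yes _)   = refl
    matched (no x↛y) = contradiction x↦y x↛y

  sideColour-tail : ∀ {x y b} (xy : Arc D x y) → γ x y xy ≡ sideColour b → side x ≡ b
  sideColour-tail xy e with γ-cases xy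
  ... | inj₁ (_ , s) = sideColour-injective (trans (sym s) e)
  ... | inj₂ (_ , o) = contradiction (trans (sym o) e) ordinary≢side

  -- Arcs of M at a common tail or head are equal, arcs of D ∖ M are coloured properly
  -- by γ₀, and side colours never meet ordinary ones.
  proper : Proper D γ
  proper = out , into
    where
    out : ∀ u v w (p : Arc D u v) (q : Arc D u w) → v ≢ w → γ u v p ≢ γ u w q
    out u v w p q v≢w same with γ-cases p | γ-cases q
    ... | inj₁ (uv , _) | inj₁ (uw , _)  = v≢w (just-injective (trans (sym uv) uw))
    ... | inj₁ (_ , s)  | inj₂ (_ , o)   = ordinary≢side (trans (sym o) (trans (sym same) s))
    ... | inj₂ (_ , o)  | inj₁ (_ , s)   = ordinary≢side (trans (sym o) (trans same s))
    ... | inj₂ (p′ , o) | inj₂ (q′ , o′) =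
          proj₁ γ₀-proper u v w p′ q′ v≢w (ordinaryColour-injective (trans (sym o) (trans same o′)))
    into : ∀ u w v (p : Arc D u v) (q : Arc D w v) → u ≢ w → γ u v p ≢ γ w v q
    into u w v p q u≢w same with γ-cases p | γ-cases q
    ... | inj₁ (uv , _) | inj₁ (wv , _)  = u≢w (injective uv wv)
    ... | inj₁ (_ , s)  | inj₂ (_ , o)   = ordinary≢side (trans (sym o) (trans (sym same) s))
    ... | inj₂ (_ , o)  | inj₁ (_ , s)   = ordinary≢side (trans (sym o) (trans same s))
    ... | inj₂ (p′ , o) | inj₂ (q′ , o′) =
          proj₂ γ₀-proper u w v p′ q′ u≢w (ordinaryColour-injective (trans (sym o) (trans same o′)))

  -- By maximality of M, u is matched as a tail or v as a head.  In the first case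
  -- sideColour (side u) ∈ S⁺(u) but ∉ S⁺(v), as out-arcs of v with a side colour carry
  -- side v.  In the second, with xv ∈ M and side x = side u (both differ from side v),
  -- sideColour (side x) ∈ S⁻(v) but ∉ S⁻(u), as tails of in-arcs of u lie off side u.
  neighbour-distinguishing : (∀ u v → Arc D u v → side u ≢ side v) → NeighbourDistinguishing D γ
  neighbour-distinguishing bipartite u v uv (same⁺ , same⁻) with M-maximal u v uv
  ... | inj₁ (y , u↦y) =
    let z , vz , e = proj₁ (same⁺ (sideColour (side u))) (y , on-arcs u↦y , γ-matched _ u↦y)
    in  bipartite u v uv (sym (sideColour-tail vz e))
  ... | inj₂ (x , x↦v) =
    let z , zu , e = proj₂ (same⁻ (sideColour (side x))) (x , on-arcs x↦v , γ-matched _ x↦v)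
    in  bipartite z u zu (trans (sideColour-tail zu e) side-x≡side-u)
    where
    side-x≡side-u : side x ≡ side u
    side-x≡side-u = trans (¬-not (bipartite x v (on-arcs x↦v))) (sym (¬-not (bipartite u v uv)))

theorem8 : (D : Digraph) → Bipartite D →
    Σ (ArcColouring D (Δ* D + 2)) λ γ →
    Proper D γ × NeighbourDistinguishing D γ
theorem8 D (side , bipartite) = γ , proper , neighbour-distinguishing bipartite
  where open Construction D side
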